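{- Let $l$ be a positive integer and let $(U(n))_{n\geqslant0}$ be an arithmetic progression of positive integers, $U(n)=U(0)+nd$. For $n\geqslant0$ let $T(n)$ be the positive integer whose decimal representation is the concatenation of the decimal representations of $U(0),U(1),\ldots,U(n),U(n-1),\ldots,U(1),U(0)$ in this order (so $T(0)=U(0)$; e.g. for $U(n)=n+1$ one gets $1,121,12321,1234321,\ldots$). If $n\geqslant 0$ is such that $U(n),U(n+1),U(n+2),U(n+3)$ all have exactly $l$ decimal digits, then $$T(n+3)-\left(1+10^l+10^{2l}\right)T(n+2)+\left(10^l+10^{2l}+10^{3l}\right)T(n+1)-10^{3l}\,T(n)=0 .$$
   Context: All concatenations are of decimal representations of positive integers; the number of decimal digits of a positive integer $m$ is $\lceil \log_{10}(m+1)\rceil$. -}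

module Defs where

open import Data.Nat using (ℕ; zero; suc; _+_; _*_; _^_; _/_)
open import Data.List using (List; []; _∷_; _++_; map; reverse; upTo; foldl)

-- number of decimal digits of a positive integer m:
-- ⌈log₁₀(m+1)⌉, i.e. the number of times one divides by 10 before reaching 0
-- (fuel-bounded; fuel m suffices since m / 10 < m for m > 0)
digitsAux : ℕ → ℕ → ℕ
digitsAux zero    m       = zero
digitsAux (suc f) zero    = zero
digitsAux (suc f) (suc m) = suc (digitsAux f (suc m / 10))

digits : ℕ → ℕ
digits m = digitsAux m m

concat : ℕ → ℕ → ℕ
concat a b = a * 10 ^ digits b + b

concatList : List ℕ → ℕ
concatList []       = 0
concatList (x ∷ xs) = foldl concat x xs

U : ℕ → ℕ → ℕ → ℕ
U U0 d n = U0 + n * d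

T : ℕ → ℕ → ℕ → ℕ
T U0 d n = concatList (map (U U0 d) (upTo (suc n) ++ reverse (upTo n)))

-- Write X = 10^l. Splitting the list U(0),…,U(k),…,U(0) at the l-digit block
-- U(n),…,U(k),…,U(n) shows T(k) = (P X^(2(k-n)+1) + M(k)) Y + Q for k = n,…,n+3, with P, Y, Q
-- independent of k and M(k) the base-X numeral with digits U(n),…,U(k),…,U(n).
-- For an arithmetic progression M(k) is a combination of X^(2(k-n)), X^(k-n) and 1, so the
-- four values are annihilated by (E - 1)(E - X)(E - X²), which is the stated recurrence.
module Submission where

open import Defs
open import Data.Nat using (ℕ; suc; _≥_) renaming (_*_ to _*ℕ_)
open import Data.Integer using (ℤ; +_; _+_; _-_; _*_; _^_)
open import Relation.Binary.PropositionalEquality using (_≡_)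

import Data.Nat as ℕ
import Data.Nat.Properties as ℕ
import Data.Integer.Properties as ℤ
import Data.Nat.Tactic.RingSolver as ℕ-Solver
import Data.Integer.Tactic.RingSolver as ℤ-Solver
open import Data.List using (List; []; _∷_; _++_; _∷ʳ_; map; reverse; upTo; foldl; length)
open import Data.Nat.ListAction using (sum)
open import Data.List.Properties using (foldl-++; map-++; ++-assoc; ++-identityʳ; reverse-++; reverse-map; upTo-∷ʳ)
open import Data.List.Relation.Unary.All using (All; []; _∷_)
open import Relation.Binary.PropositionalEquality using (refl; sym; trans; cong; cong₂; module ≡-Reasoning)

open ≡-Reasoning

width : List ℕ → ℕ
width xs = sum (map digits xs)

foldl-concat : ∀ a xs → foldl concat a xs ≡ a ℕ.* 10 ℕ.^ width xs ℕ.+ concatList xs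
foldl-concat a []       = sym (trans (cong (ℕ._+ 0) (ℕ.*-identityʳ a)) (ℕ.+-identityʳ a))
foldl-concat a (x ∷ xs) = begin
  foldl concat (concat a x) xs
    ≡⟨ foldl-concat (concat a x) xs ⟩
  (a ℕ.* 10 ℕ.^ digits x ℕ.+ x) ℕ.* 10 ℕ.^ width xs ℕ.+ concatList xs
    ≡⟨ distribute a x (10 ℕ.^ digits x) (10 ℕ.^ width xs) (concatList xs) ⟩
  a ℕ.* (10 ℕ.^ digits x ℕ.* 10 ℕ.^ width xs) ℕ.+ (x ℕ.* 10 ℕ.^ width xs ℕ.+ concatList xs)
    ≡⟨ cong₂ ℕ._+_ (cong (a ℕ.*_) (sym (ℕ.^-distribˡ-+-* 10 (digits x) (width xs))))
                   (sym (foldl-concat x xs)) ⟩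
  a ℕ.* 10 ℕ.^ width (x ∷ xs) ℕ.+ concatList (x ∷ xs) ∎
  where
  distribute : ∀ a x p q c → (a ℕ.* p ℕ.+ x) ℕ.* q ℕ.+ c ≡ a ℕ.* (p ℕ.* q) ℕ.+ (x ℕ.* q ℕ.+ c)
  distribute = ℕ-Solver.solve-∀

concatList-++ : ∀ xs ys → concatList (xs ++ ys) ≡ concatList xs ℕ.* 10 ℕ.^ width ys ℕ.+ concatList ys
concatList-++ []       ys = refl
concatList-++ (x ∷ xs) ys = trans (foldl-++ concat x xs ys) (foldl-concat (foldl concat x xs) ys)

horner : ℕ → ℕ → List ℕ → ℕ
horner b = foldl (λ acc x → acc ℕ.* b ℕ.+ x)

foldl-concat-uniform : ∀ l a xs → All (λ x → digits x ≡ l) xs →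
                       foldl concat a xs ≡ horner (10 ℕ.^ l) a xs
foldl-concat-uniform l a []       []       = refl
foldl-concat-uniform l a (x ∷ xs) (refl ∷ ps) = foldl-concat-uniform l (concat a x) xs ps

concatList-uniform : ∀ l xs → All (λ x → digits x ≡ l) xs → concatList xs ≡ horner (10 ℕ.^ l) 0 xs
concatList-uniform l []       []       = refl
concatList-uniform l (x ∷ xs) (_ ∷ ps) = foldl-concat-uniform l x xs ps

width-uniform : ∀ l xs → All (λ x → digits x ≡ l) xs → width xs ≡ length xs ℕ.* l
width-uniform l []       []       = refl
width-uniform l (x ∷ xs) (p ∷ ps) = cong₂ ℕ._+_ p (width-uniform l xs ps)

upTo-+ : ∀ m n → upTo (m ℕ.+ n) ≡ upTo n ++ map (ℕ._+ n) (upTo m)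
upTo-+ ℕ.zero    n = sym (++-identityʳ (upTo n))
upTo-+ (suc m) n = begin
  upTo (suc (m ℕ.+ n))                                ≡⟨ sym (upTo-∷ʳ (m ℕ.+ n)) ⟩
  upTo (m ℕ.+ n) ∷ʳ (m ℕ.+ n)                         ≡⟨ cong (_∷ʳ (m ℕ.+ n)) (upTo-+ m n) ⟩
  (upTo n ++ map (ℕ._+ n) (upTo m)) ∷ʳ (m ℕ.+ n)      ≡⟨ ++-assoc (upTo n) _ _ ⟩
  upTo n ++ (map (ℕ._+ n) (upTo m) ∷ʳ (m ℕ.+ n))      ≡⟨ cong (upTo n ++_) (sym (map-++ (ℕ._+ n) (upTo m) _)) ⟩
  upTo n ++ map (ℕ._+ n) (upTo m ∷ʳ m)                ≡⟨ cong (λ ys → upTo n ++ map (ℕ._+ n) ys) (upTo-∷ʳ m) ⟩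
  upTo n ++ map (ℕ._+ n) (upTo (suc m))               ∎

palindrome : ℕ → List ℕ
palindrome n = upTo (suc n) ++ reverse (upTo n)

palindrome-+ : ∀ m n →
  palindrome (m ℕ.+ n) ≡ upTo n ++ map (ℕ._+ n) (palindrome m) ++ reverse (upTo n)
palindrome-+ m n = begin
  upTo (suc m ℕ.+ n) ++ reverse (upTo (m ℕ.+ n))
    ≡⟨ cong₂ (λ xs ys → xs ++ reverse ys) (upTo-+ (suc m) n) (upTo-+ m n) ⟩
  (upTo n ++ f (upTo (suc m))) ++ reverse (upTo n ++ f (upTo m))
    ≡⟨ cong ((upTo n ++ f (upTo (suc m))) ++_) (reverse-++ (upTo n) (f (upTo m))) ⟩
  (upTo n ++ f (upTo (suc m))) ++ reverse (f (upTo m)) ++ reverse (upTo n)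
    ≡⟨ cong (λ ys → (upTo n ++ f (upTo (suc m))) ++ ys ++ reverse (upTo n)) (sym (reverse-map (ℕ._+ n) (upTo m))) ⟩
  (upTo n ++ f (upTo (suc m))) ++ f (reverse (upTo m)) ++ reverse (upTo n)
    ≡⟨ ++-assoc (upTo n) _ _ ⟩
  upTo n ++ f (upTo (suc m)) ++ f (reverse (upTo m)) ++ reverse (upTo n)
    ≡⟨ cong (upTo n ++_) (sym (++-assoc (f (upTo (suc m))) _ _)) ⟩
  upTo n ++ (f (upTo (suc m)) ++ f (reverse (upTo m))) ++ reverse (upTo n)
    ≡⟨ cong (λ ys → upTo n ++ ys ++ reverse (upTo n)) (sym (map-++ (ℕ._+ n) (upTo (suc m)) _)) ⟩
  upTo n ++ f (palindrome m) ++ reverse (upTo n) ∎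
  where
  f : List ℕ → List ℕ
  f = map (ℕ._+ n)

-- uᵢ is U U0 d (i + n) and Xᵏ is X ^ k, unfolded because the solver reflects neither.
palindromic-block-recurrence : ∀ X P Y Q U0 d n →
  let u₀ = U0 ℕ.+ n ℕ.* d
      u₁ = U0 ℕ.+ (1 ℕ.+ n) ℕ.* d
      u₂ = U0 ℕ.+ (2 ℕ.+ n) ℕ.* d
      u₃ = U0 ℕ.+ (3 ℕ.+ n) ℕ.* d
      X¹ = X ℕ.* 1
      X² = X ℕ.* X¹
      X³ = X ℕ.* X²
      X⁴ = X ℕ.* X³
      X⁵ = X ℕ.* X⁴
      X⁶ = X ℕ.* X⁵
      X⁷ = X ℕ.* X⁶
  in (P ℕ.* X⁷ ℕ.+ ((((((u₀ ℕ.* X ℕ.+ u₁) ℕ.* X ℕ.+ u₂) ℕ.* X ℕ.+ u₃) ℕ.* X ℕ.+ u₂) ℕ.* X ℕ.+ u₁) ℕ.* X ℕ.+ u₀)) ℕ.* Y ℕ.+ Q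
     ℕ.+ (X ℕ.+ X² ℕ.+ X³) ℕ.* ((P ℕ.* X³ ℕ.+ ((u₀ ℕ.* X ℕ.+ u₁) ℕ.* X ℕ.+ u₀)) ℕ.* Y ℕ.+ Q)
   ≡ (1 ℕ.+ X ℕ.+ X²) ℕ.* ((P ℕ.* X⁵ ℕ.+ ((((u₀ ℕ.* X ℕ.+ u₁) ℕ.* X ℕ.+ u₂) ℕ.* X ℕ.+ u₁) ℕ.* X ℕ.+ u₀)) ℕ.* Y ℕ.+ Q)
     ℕ.+ X³ ℕ.* ((P ℕ.* X¹ ℕ.+ u₀) ℕ.* Y ℕ.+ Q)
palindromic-block-recurrence = ℕ-Solver.solve-∀

module _ (U0 d : ℕ) where

  middle : ℕ → ℕ → List ℕ
  middle m n = map (U U0 d) (map (ℕ._+ n) (palindrome m))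

  T-split : ∀ l m n → All (λ x → digits x ≡ l) (middle m n) →
    T U0 d (m ℕ.+ n)
      ≡ (concatList (map (U U0 d) (upTo n)) ℕ.* (10 ℕ.^ l) ℕ.^ length (middle m n)
         ℕ.+ horner (10 ℕ.^ l) 0 (middle m n))
        ℕ.* 10 ℕ.^ width (map (U U0 d) (reverse (upTo n)))
        ℕ.+ concatList (map (U U0 d) (reverse (upTo n)))
  T-split l m n uniform = begin
    concatList (map u (palindrome (m ℕ.+ n)))
      ≡⟨ cong (λ xs → concatList (map u xs)) (palindrome-+ m n) ⟩
    concatList (map u (upTo n ++ map (ℕ._+ n) (palindrome m) ++ reverse (upTo n)))
      ≡⟨ cong concatList (trans (map-++ u (upTo n) _) (cong (P ++_) (map-++ u (map (ℕ._+ n) (palindrome m)) _))) ⟩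
    concatList (P ++ M ++ Q)
      ≡⟨ cong concatList (sym (++-assoc P M Q)) ⟩
    concatList ((P ++ M) ++ Q)
      ≡⟨ concatList-++ (P ++ M) Q ⟩
    concatList (P ++ M) ℕ.* 10 ℕ.^ width Q ℕ.+ concatList Q
      ≡⟨ cong (λ z → z ℕ.* 10 ℕ.^ width Q ℕ.+ concatList Q) (concatList-++ P M) ⟩
    (concatList P ℕ.* 10 ℕ.^ width M ℕ.+ concatList M) ℕ.* 10 ℕ.^ width Q ℕ.+ concatList Q
      ≡⟨ cong (λ z → z ℕ.* 10 ℕ.^ width Q ℕ.+ concatList Q)
              (cong₂ ℕ._+_ (cong (concatList P ℕ.*_) scale) (concatList-uniform l M uniform)) ⟩
    (concatList P ℕ.* (10 ℕ.^ l) ℕ.^ length M ℕ.+ horner (10 ℕ.^ l) 0 M) ℕ.* 10 ℕ.^ width Q ℕ.+ concatList Q ∎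
    where
    u = U U0 d
    P = map u (upTo n)
    M = middle m n
    Q = map u (reverse (upTo n))
    scale : 10 ℕ.^ width M ≡ (10 ℕ.^ l) ℕ.^ length M
    scale = begin
      10 ℕ.^ width M              ≡⟨ cong (10 ℕ.^_) (width-uniform l M uniform) ⟩
      10 ℕ.^ (length M ℕ.* l)     ≡⟨ cong (10 ℕ.^_) (ℕ.*-comm (length M) l) ⟩
      10 ℕ.^ (l ℕ.* length M)     ≡⟨ sym (ℕ.^-*-assoc 10 l (length M)) ⟩
      (10 ℕ.^ l) ℕ.^ length M     ∎


  T-recurrence : ∀ l n →
    digits (U U0 d n) ≡ l → digits (U U0 d (1 ℕ.+ n)) ≡ l →
    digits (U U0 d (2 ℕ.+ n)) ≡ l → digits (U U0 d (3 ℕ.+ n)) ≡ l →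
    let X = 10 ℕ.^ l in
    T U0 d (3 ℕ.+ n) ℕ.+ (X ℕ.+ X ℕ.^ 2 ℕ.+ X ℕ.^ 3) ℕ.* T U0 d (1 ℕ.+ n)
      ≡ (1 ℕ.+ X ℕ.+ X ℕ.^ 2) ℕ.* T U0 d (2 ℕ.+ n) ℕ.+ X ℕ.^ 3 ℕ.* T U0 d n
  T-recurrence l n h₀ h₁ h₂ h₃ =
    trans (cong₂ (λ t₃ t₁ → t₃ ℕ.+ (X ℕ.+ X ℕ.^ 2 ℕ.+ X ℕ.^ 3) ℕ.* t₁)
                 (T-split l 3 n (h₀ ∷ h₁ ∷ h₂ ∷ h₃ ∷ h₂ ∷ h₁ ∷ h₀ ∷ []))
                 (T-split l 1 n (h₀ ∷ h₁ ∷ h₀ ∷ [])))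
    (trans (palindromic-block-recurrence X P Y Q U0 d n)
           (sym (cong₂ (λ t₂ t₀ → (1 ℕ.+ X ℕ.+ X ℕ.^ 2) ℕ.* t₂ ℕ.+ X ℕ.^ 3 ℕ.* t₀)
                       (T-split l 2 n (h₀ ∷ h₁ ∷ h₂ ∷ h₁ ∷ h₀ ∷ []))
                       (T-split l 0 n (h₀ ∷ [])))))
    where
    X = 10 ℕ.^ l
    P = concatList (map (U U0 d) (upTo n))
    Y = 10 ℕ.^ width (map (U U0 d) (reverse (upTo n)))
    Q = concatList (map (U U0 d) (reverse (upTo n)))

pos-^ : ∀ m k → + (m ℕ.^ k) ≡ (+ m) ^ k
pos-^ m ℕ.zero  = refl
pos-^ m (suc k) = trans (ℤ.pos-* m (m ℕ.^ k)) (cong (+ m *_) (pos-^ m k))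

pos-10^-^ : ∀ l k → + ((10 ℕ.^ l) ℕ.^ k) ≡ (+ 10) ^ (k *ℕ l)
pos-10^-^ l k = begin
  + ((10 ℕ.^ l) ℕ.^ k)   ≡⟨ pos-^ (10 ℕ.^ l) k ⟩
  (+ (10 ℕ.^ l)) ^ k     ≡⟨ cong (_^ k) (pos-^ 10 l) ⟩
  ((+ 10) ^ l) ^ k       ≡⟨ ℤ.^-*-assoc (+ 10) l k ⟩
  (+ 10) ^ (l *ℕ k)      ≡⟨ cong ((+ 10) ^_) (ℕ.*-comm l k) ⟩
  (+ 10) ^ (k *ℕ l)      ∎

sub-free⇒recurrence : ∀ (t₃ t₂ t₁ t₀ a b c : ℤ) → t₃ + a * t₁ ≡ b * t₂ + c * t₀ →
                      t₃ - b * t₂ + a * t₁ - c * t₀ ≡ + 0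
sub-free⇒recurrence t₃ t₂ t₁ t₀ a b c eq = begin
  t₃ - b * t₂ + a * t₁ - c * t₀           ≡⟨ regroup t₃ t₂ t₁ t₀ a b c ⟩
  (t₃ + a * t₁) - (b * t₂ + c * t₀)       ≡⟨ cong (_- (b * t₂ + c * t₀)) eq ⟩
  (b * t₂ + c * t₀) - (b * t₂ + c * t₀)   ≡⟨ ℤ.+-inverseʳ (b * t₂ + c * t₀) ⟩
  + 0                                     ∎
  where
  regroup : ∀ t₃ t₂ t₁ t₀ a b c →
            t₃ - b * t₂ + a * t₁ - c * t₀ ≡ (t₃ + a * t₁) - (b * t₂ + c * t₀)
  regroup = ℤ-Solver.solve-∀

recurrence-ℕ⇒ℤ : ∀ l t₃ t₂ t₁ t₀ → let X = 10 ℕ.^ l in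
  t₃ ℕ.+ (X ℕ.+ X ℕ.^ 2 ℕ.+ X ℕ.^ 3) ℕ.* t₁ ≡ (1 ℕ.+ X ℕ.+ X ℕ.^ 2) ℕ.* t₂ ℕ.+ X ℕ.^ 3 ℕ.* t₀ →
  (+ t₃) - (+ 1 + (+ 10) ^ l + (+ 10) ^ (2 *ℕ l)) * (+ t₂)
    + ((+ 10) ^ l + (+ 10) ^ (2 *ℕ l) + (+ 10) ^ (3 *ℕ l)) * (+ t₁)
    - (+ 10) ^ (3 *ℕ l) * (+ t₀)
    ≡ + 0
recurrence-ℕ⇒ℤ l t₃ t₂ t₁ t₀ eq = sub-free⇒recurrence (+ t₃) (+ t₂) (+ t₁) (+ t₀) a b c (begin
  + t₃ + a * + t₁                   ≡⟨ cong (λ z → + t₃ + z * + t₁) (sym a-cast) ⟩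
  + t₃ + + A * + t₁                 ≡⟨ sym (cong (_+_ (+ t₃)) (ℤ.pos-* A t₁)) ⟩
  + t₃ + + (A ℕ.* t₁)               ≡⟨ sym (ℤ.pos-+ t₃ (A ℕ.* t₁)) ⟩
  + (t₃ ℕ.+ A ℕ.* t₁)               ≡⟨ cong +_ eq ⟩
  + (B ℕ.* t₂ ℕ.+ C ℕ.* t₀)         ≡⟨ ℤ.pos-+ (B ℕ.* t₂) (C ℕ.* t₀) ⟩
  + (B ℕ.* t₂) + + (C ℕ.* t₀)       ≡⟨ cong₂ _+_ (ℤ.pos-* B t₂) (ℤ.pos-* C t₀) ⟩
  + B * + t₂ + + C * + t₀           ≡⟨ cong₂ (λ y z → y * + t₂ + z * + t₀) b-cast c-cast ⟩
  b * + t₂ + c * + t₀               ∎)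
  where
  X = 10 ℕ.^ l
  A = X ℕ.+ X ℕ.^ 2 ℕ.+ X ℕ.^ 3
  B = 1 ℕ.+ X ℕ.+ X ℕ.^ 2
  C = X ℕ.^ 3
  a = (+ 10) ^ l + (+ 10) ^ (2 *ℕ l) + (+ 10) ^ (3 *ℕ l)
  b = + 1 + (+ 10) ^ l + (+ 10) ^ (2 *ℕ l)
  c = (+ 10) ^ (3 *ℕ l)
  a-cast : + A ≡ a
  a-cast = trans (ℤ.pos-+ (X ℕ.+ X ℕ.^ 2) C)
                 (cong₂ _+_ (trans (ℤ.pos-+ X (X ℕ.^ 2)) (cong₂ _+_ (pos-^ 10 l) (pos-10^-^ l 2)))
                            (pos-10^-^ l 3))
  b-cast : + B ≡ b
  b-cast = trans (ℤ.pos-+ (1 ℕ.+ X) (X ℕ.^ 2))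
                 (cong₂ _+_ (trans (ℤ.pos-+ 1 X) (cong (_+_ (+ 1)) (pos-^ 10 l))) (pos-10^-^ l 2))
  c-cast : + C ≡ c
  c-cast = pos-10^-^ l 3

lemma3 : (l U0 d n : ℕ) → l ≥ 1 → U0 ≥ 1 →
    digits (U U0 d n) ≡ l → digits (U U0 d (suc n)) ≡ l →
    digits (U U0 d (suc (suc n))) ≡ l → digits (U U0 d (suc (suc (suc n)))) ≡ l →
    (+ T U0 d (suc (suc (suc n))))
      - (+ 1 + (+ 10) ^ l + (+ 10) ^ (2 *ℕ l)) * (+ T U0 d (suc (suc n)))
      + ((+ 10) ^ l + (+ 10) ^ (2 *ℕ l) + (+ 10) ^ (3 *ℕ l)) * (+ T U0 d (suc n))
      - (+ 10) ^ (3 *ℕ l) * (+ T U0 d n)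
      ≡ + 0
lemma3 l U0 d n _ _ h₀ h₁ h₂ h₃ =
  recurrence-ℕ⇒ℤ l (T U0 d (3 ℕ.+ n)) (T U0 d (2 ℕ.+ n)) (T U0 d (1 ℕ.+ n)) (T U0 d n)
    (T-recurrence U0 d l n h₀ h₁ h₂ h₃)
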